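{- Let $m(n)$ denote the number of maximal independent sets of the meta-pentagonal cactus $M(n)$. Then $m(1)=5$, $m(2)=13$, and $m(n)=3m(n-1)-m(n-2)$ for all $n\ge 3$.
   Context: For $n\ge 1$, the meta-pentagonal cactus $M(n)$ is the graph formed by a chain of $n$ 5-cycles $B_1,\dots,B_n$, where for each $1\le i\le n-1$ the consecutive cycles $B_i$ and $B_{i+1}$ share exactly one vertex, non-consecutive cycles share no vertex, every vertex lies in at most two cycles, and for each $2\le i\le n-1$ the two shared (cut) vertices of $B_i$ are at distance two in $B_i$. An independent set is maximal if no further vertex can be added while keeping it independent. -}

module Defs where

open import Data.Nat using (ℕ; zero; suc; _+_; _*_; _≡ᵇ_)
open import Data.Bool using (Bool; true; false; _∧_; _∨_; not)
open import Data.Fin using (Fin; toℕ)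
open import Data.Vec using (Vec; []; _∷_; lookup)
open import Data.List using (List; []; _∷_; _++_; map; allFin; upTo; length; filterᵇ)
open import Data.Bool.ListAction using (all; any)
open import Data.Product using (_×_; _,_)

-- For i = 0, ..., n-1 the 5-cycle B_{i+1} has vertex set
--   {4i, 4i+1, 4i+2, 4i+3, 4i+4}
-- and edges (cyclic order  4i – 4i+1 – 4i+4 – 4i+2 – 4i+3 – 4i):
--   {4i,4i+1}, {4i+1,4i+4}, {4i+4,4i+2}, {4i+2,4i+3}, {4i+3,4i}.
-- Consecutive cycles B_{i+1}, B_{i+2} share exactly the vertex 4(i+1);
-- non-consecutive cycles are disjoint; every vertex lies in at most two
-- cycles; and the two cut vertices 4i, 4i+4 of an inner cycle are at
-- distance two in it (via 4i+1).  These conditions determine M(n) up to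
-- isomorphism, so this is a faithful model.

cycleEdges : ℕ → List (ℕ × ℕ)
cycleEdges i =
  (4 * i , 4 * i + 1) ∷ (4 * i + 1 , 4 * i + 4) ∷ (4 * i + 4 , 4 * i + 2) ∷
  (4 * i + 2 , 4 * i + 3) ∷ (4 * i + 3 , 4 * i) ∷ []

edges : ℕ → List (ℕ × ℕ)
edges n = go (upTo n)
  where
  go : List ℕ → List (ℕ × ℕ)
  go [] = []
  go (i ∷ is) = cycleEdges i ++ go is

adjℕ : ℕ → ℕ → ℕ → Bool
adjℕ n u v = any (λ { (a , b) → ((a ≡ᵇ u) ∧ (b ≡ᵇ v)) ∨ ((a ≡ᵇ v) ∧ (b ≡ᵇ u)) }) (edges n)

V : ℕ → ℕ
V n = suc (4 * n)

Vertex : ℕ → Set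
Vertex n = Fin (V n)

adj : (n : ℕ) → Vertex n → Vertex n → Bool
adj n u v = adjℕ n (toℕ u) (toℕ v)

VSet : ℕ → Set
VSet n = Vec Bool (V n)

isIndependent : (n : ℕ) → VSet n → Bool
isIndependent n S =
  all (λ u → all (λ v → not (lookup S u ∧ lookup S v ∧ adj n u v)) (allFin (V n))) (allFin (V n))

-- S is maximal: every vertex outside S has a neighbour in S
-- (equivalently, no vertex can be added keeping S independent)
isDominating : (n : ℕ) → VSet n → Bool
isDominating n S =
  all (λ v → lookup S v ∨ any (λ u → lookup S u ∧ adj n u v) (allFin (V n))) (allFin (V n))

isMaximalIndependent : (n : ℕ) → VSet n → Bool
isMaximalIndependent n S = isIndependent n S ∧ isDominating n S

allSubsets : (k : ℕ) → List (Vec Bool k)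
allSubsets zero = [] ∷ []
allSubsets (suc k) = map (true ∷_) (allSubsets k) ++ map (false ∷_) (allSubsets k)

m : ℕ → ℕ
m n = length (filterᵇ (isMaximalIndependent n) (allSubsets (V n)))

-- With the vertices numbered as in `cycleEdges`, M(n+1) is the pentagon 0–1–4–2–3 glued at vertex 4
-- to a copy of M(n) shifted by 4.  Call a vertex set of M(n) almost maximal if it is independent and
-- dominates every vertex except possibly the root 0, and record its root state (root chosen?, root
-- dominated?).  A maximal independent set of M(n+1) is an almost maximal set of M(n) together with
-- four bits on the new pentagon subject to local conditions, so the numbers of almost maximal sets
-- per root state evolve by a fixed transfer matrix.  From n = 1 on only the states p = (chosen,
-- dominated) and q = (free, dominated) occur; they evolve as (p, q) ↦ (p + q, p + 2q) and m = p + q,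
-- whence m(n+3) + m(n+1) = 3 m(n+2).
module Submission where

open import Defs
open import Data.Nat using (ℕ; zero; suc; _+_; _*_; _∸_; _≡ᵇ_; _<ᵇ_)
open import Data.Nat.Properties using (*-suc; +-assoc; +-identityʳ; m+n∸n≡m)
open import Data.Nat.Tactic.RingSolver using (solve-∀)
open import Data.Bool using (Bool; true; false; _∧_; _∨_; not; _xor_; T; if_then_else_)
open import Data.Bool.Properties using (∨-identityʳ; ∨-comm; ∨-assoc; ∧-zeroʳ; ∧-identityʳ; ∧-comm; T-∧)
open import Data.Bool.ListAction using (or; all; any)
open import Data.List using (List; []; _∷_; _++_; map; concatMap; applyUpTo; upTo; tabulate; allFin; length; filterᵇ)
open import Data.List.Properties using (map-applyUpTo; map-∘)
open import Data.Product using (_×_; _,_; proj₁; proj₂)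
open import Data.Fin using (Fin; zero; suc; toℕ)
open import Data.Vec using (Vec; []; _∷_; lookup)
open import Function using (_∘_; id)
open import Function.Bundles using (Equivalence)
open import Relation.Binary.PropositionalEquality

private
  variable
    X Y : Set

-- Quantifiers, truth tables and counting

any-cong : {p q : X → Bool} → (∀ x → p x ≡ q x) → (xs : List X) → any p xs ≡ any q xs
any-cong h []       = refl
any-cong h (x ∷ xs) = cong₂ _∨_ (h x) (any-cong h xs)

any-false : (xs : List X) → any (λ _ → false) xs ≡ false
any-false []       = refl
any-false (x ∷ xs) = any-false xs

any-++ : (p : X → Bool) (xs ys : List X) → any p (xs ++ ys) ≡ any p xs ∨ any p ys
any-++ p []       ys = refl
any-++ p (x ∷ xs) ys = trans (cong (p x ∨_) (any-++ p xs ys)) (sym (∨-assoc (p x) _ _))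

any-concatMap : (p : Y → Bool) (f : X → List Y) (xs : List X) → any p (concatMap f xs) ≡ any (any p ∘ f) xs
any-concatMap p f []       = refl
any-concatMap p f (x ∷ xs) =
  trans (any-++ p (f x) (concatMap f xs)) (cong (any p (f x) ∨_) (any-concatMap p f xs))

any-map : (p : Y → Bool) (f : X → Y) (xs : List X) → any p (map f xs) ≡ any (p ∘ f) xs
any-map p f xs = cong or (sym (map-∘ xs))

-- Recursive, so that a condition on `b ∷ S` unfolds definitionally into one on `b` and one on `S`.
allᶠ : ∀ {k} → (Fin k → Bool) → Bool
allᶠ {zero}  p = true
allᶠ {suc k} p = p zero ∧ allᶠ (p ∘ suc)

anyᶠ : ∀ {k} → (Fin k → Bool) → Bool
anyᶠ {zero}  p = false
anyᶠ {suc k} p = p zero ∨ anyᶠ (p ∘ suc)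

allᶠ-cong : ∀ {k} {p q : Fin k → Bool} → (∀ i → p i ≡ q i) → allᶠ p ≡ allᶠ q
allᶠ-cong {zero}  h = refl
allᶠ-cong {suc k} h = cong₂ _∧_ (h zero) (allᶠ-cong (h ∘ suc))

anyᶠ-cong : ∀ {k} {p q : Fin k → Bool} → (∀ i → p i ≡ q i) → anyᶠ p ≡ anyᶠ q
anyᶠ-cong {zero}  h = refl
anyᶠ-cong {suc k} h = cong₂ _∨_ (h zero) (anyᶠ-cong (h ∘ suc))

allᶠ-true : ∀ k → allᶠ {k} (λ _ → true) ≡ true
allᶠ-true zero    = refl
allᶠ-true (suc k) = allᶠ-true k

anyᶠ-false : ∀ k → anyᶠ {k} (λ _ → false) ≡ false
anyᶠ-false zero    = refl
anyᶠ-false (suc k) = anyᶠ-false k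

all-tabulate : ∀ {k} (p : X → Bool) (f : Fin k → X) → all p (tabulate f) ≡ allᶠ (p ∘ f)
all-tabulate {k = zero}  p f = refl
all-tabulate {k = suc k} p f = cong (p (f zero) ∧_) (all-tabulate p (f ∘ suc))

any-tabulate : ∀ {k} (p : X → Bool) (f : Fin k → X) → any p (tabulate f) ≡ anyᶠ (p ∘ f)
any-tabulate {k = zero}  p f = refl
any-tabulate {k = suc k} p f = cong (p (f zero) ∨_) (any-tabulate p (f ∘ suc))

BoolFun : ℕ → Set
BoolFun zero    = Bool
BoolFun (suc k) = Bool → BoolFun k

agree : ∀ k → BoolFun k → BoolFun k → Bool
agree zero    a b = not (a xor b)
agree (suc k) f g = agree k (f true) (g true) ∧ agree k (f false) (g false)

Pointwise : ∀ k → BoolFun k → BoolFun k → Set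
Pointwise zero    a b = a ≡ b
Pointwise (suc k) f g = ∀ b → Pointwise k (f b) (g b)

by-truth-table : ∀ k (f g : BoolFun k) {_ : T (agree k f g)} → Pointwise k f g
by-truth-table zero    true  true  = refl
by-truth-table zero    false false = refl
by-truth-table (suc k) f g {ok} true  = by-truth-table k (f true) (g true) {proj₁ (Equivalence.to T-∧ ok)}
by-truth-table (suc k) f g {ok} false = by-truth-table k (f false) (g false) {proj₂ (Equivalence.to T-∧ ok)}

count : (X → Bool) → List X → ℕ
count p xs = length (filterᵇ p xs)

χ : Bool → ℕ
χ b = if b then 1 else 0

count-∷ : (p : X → Bool) (x : X) (xs : List X) → count p (x ∷ xs) ≡ χ (p x) + count p xs
count-∷ p x xs with p x
... | true  = refl
... | false = refl

count-cong : {p q : X → Bool} → (∀ x → p x ≡ q x) → ∀ xs → count p xs ≡ count q xs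
count-cong h []                   = refl
count-cong {p = p} {q} h (x ∷ xs) =
  trans (count-∷ p x xs) (trans (cong₂ _+_ (cong χ (h x)) (count-cong h xs)) (sym (count-∷ q x xs)))

count-false : (xs : List X) → count (λ _ → false) xs ≡ 0
count-false []       = refl
count-false (x ∷ xs) = count-false xs

count-∧ : (p : X → Bool) (b : Bool) (xs : List X) → count (λ x → p x ∧ b) xs ≡ χ b * count p xs
count-∧ p true  xs = trans (count-cong (λ x → ∧-identityʳ (p x)) xs) (sym (+-identityʳ _))
count-∧ p false xs = trans (count-cong (λ x → ∧-zeroʳ (p x)) xs) (count-false xs)

count-++ : (p : X → Bool) (xs ys : List X) → count p (xs ++ ys) ≡ count p xs + count p ys
count-++ p []       ys = refl
count-++ p (x ∷ xs) ys =
  trans (count-∷ p x (xs ++ ys))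
        (trans (cong (χ (p x) +_) (count-++ p xs ys))
               (trans (sym (+-assoc (χ (p x)) _ _)) (cong (_+ count p ys) (sym (count-∷ p x xs)))))

count-map : (p : Y → Bool) (f : X → Y) (xs : List X) → count p (map f xs) ≡ count (p ∘ f) xs
count-map p f []       = refl
count-map p f (x ∷ xs) =
  trans (count-∷ p (f x) (map f xs)) (trans (cong (χ (p (f x)) +_) (count-map p f xs)) (sym (count-∷ (p ∘ f) x xs)))

ΣBool : (Bool → ℕ) → ℕ
ΣBool f = f true + f false

ΣBool-cong : {f g : Bool → ℕ} → (∀ b → f b ≡ g b) → ΣBool f ≡ ΣBool g
ΣBool-cong h = cong₂ _+_ (h true) (h false)

count-allSubsets-suc : ∀ k (p : Vec Bool (suc k) → Bool) →
  count p (allSubsets (suc k)) ≡ ΣBool λ b → count (p ∘ (b ∷_)) (allSubsets k)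
count-allSubsets-suc k p =
  trans (count-++ p (map (true ∷_) (allSubsets k)) (map (false ∷_) (allSubsets k)))
        (cong₂ _+_ (count-map p (true ∷_) (allSubsets k)) (count-map p (false ∷_) (allSubsets k)))

count-allSubsets-4+ : ∀ k (p : Vec Bool (4 + k) → Bool) →
  count p (allSubsets (4 + k)) ≡
  ΣBool λ b₀ → ΣBool λ b₁ → ΣBool λ b₂ → ΣBool λ b₃ → count (λ R → p (b₀ ∷ b₁ ∷ b₂ ∷ b₃ ∷ R)) (allSubsets k)
count-allSubsets-4+ k p =
  trans (count-allSubsets-suc (3 + k) p) (ΣBool-cong λ b₀ →
  trans (count-allSubsets-suc (2 + k) (λ R → p (b₀ ∷ R))) (ΣBool-cong λ b₁ →
  trans (count-allSubsets-suc (1 + k) (λ R → p (b₀ ∷ b₁ ∷ R))) (ΣBool-cong λ b₂ →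
  count-allSubsets-suc k (λ R → p (b₀ ∷ b₁ ∷ b₂ ∷ R)))))

ByRootState : Set
ByRootState = Bool → Bool → ℕ

Σ₂ : ByRootState → ℕ
Σ₂ f = f true true + (f true false + (f false true + f false false))

Σ₂-cong : {f g : ByRootState} → (∀ x y → f x y ≡ g x y) → Σ₂ f ≡ Σ₂ g
Σ₂-cong h = cong₂ _+_ (h true true) (cong₂ _+_ (h true false) (cong₂ _+_ (h false true) (h false false)))

Σ₂-+ : (f g : ByRootState) → Σ₂ f + Σ₂ g ≡ Σ₂ (λ x y → f x y + g x y)
Σ₂-+ f g = interchange (f true true) (f true false) (f false true) (f false false)
                       (g true true) (g true false) (g false true) (g false false)
  where
  interchange : ∀ a b c d a′ b′ c′ d′ →
    (a + (b + (c + d))) + (a′ + (b′ + (c′ + d′))) ≡ (a + a′) + ((b + b′) + ((c + c′) + (d + d′)))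
  interchange = solve-∀

ΣBool-Σ₂ : (w : Bool → ByRootState) (C : ByRootState) →
  (ΣBool λ b → Σ₂ λ r d → w b r d * C r d) ≡ Σ₂ λ r d → ΣBool (λ b → w b r d) * C r d
ΣBool-Σ₂ w C = distrib (w true true true) (w true true false) (w true false true) (w true false false)
                       (w false true true) (w false true false) (w false false true) (w false false false)
                       (C true true) (C true false) (C false true) (C false false)
  where
  distrib : ∀ p₁ p₂ p₃ p₄ q₁ q₂ q₃ q₄ c₁ c₂ c₃ c₄ →
    (p₁ * c₁ + (p₂ * c₂ + (p₃ * c₃ + p₄ * c₄))) + (q₁ * c₁ + (q₂ * c₂ + (q₃ * c₃ + q₄ * c₄))) ≡
    (p₁ + q₁) * c₁ + ((p₂ + q₂) * c₂ + ((p₃ + q₃) * c₃ + (p₄ + q₄) * c₄))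
  distrib = solve-∀

ΣBool⁴-Σ₂ : (w : Bool → Bool → Bool → Bool → ByRootState) (C : ByRootState) →
  (ΣBool λ b₀ → ΣBool λ b₁ → ΣBool λ b₂ → ΣBool λ b₃ → Σ₂ λ r d → w b₀ b₁ b₂ b₃ r d * C r d) ≡
  Σ₂ λ r d → (ΣBool λ b₀ → ΣBool λ b₁ → ΣBool λ b₂ → ΣBool λ b₃ → w b₀ b₁ b₂ b₃ r d) * C r d
ΣBool⁴-Σ₂ w C =
  trans (ΣBool-cong λ b₀ → ΣBool-cong λ b₁ → ΣBool-cong λ b₂ → ΣBool-Σ₂ (w b₀ b₁ b₂) C)
  (trans (ΣBool-cong λ b₀ → ΣBool-cong λ b₁ → ΣBool-Σ₂ (λ b₂ r d → ΣBool λ b₃ → w b₀ b₁ b₂ b₃ r d) C)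
  (trans (ΣBool-cong λ b₀ → ΣBool-Σ₂ (λ b₁ r d → ΣBool λ b₂ → ΣBool λ b₃ → w b₀ b₁ b₂ b₃ r d) C)
         (ΣBool-Σ₂ (λ b₀ r d → ΣBool λ b₁ → ΣBool λ b₂ → ΣBool λ b₃ → w b₀ b₁ b₂ b₃ r d) C)))

count-Σ₂ : {p : X → Bool} {q : Bool → Bool → X → Bool} →
  (∀ x → χ (p x) ≡ Σ₂ (λ a b → χ (q a b x))) → ∀ xs → count p xs ≡ Σ₂ (λ a b → count (q a b) xs)
count-Σ₂ h []                   = refl
count-Σ₂ {p = p} {q} h (x ∷ xs) = begin
  count p (x ∷ xs)                                         ≡⟨ count-∷ p x xs ⟩
  χ (p x) + count p xs                                     ≡⟨ cong₂ _+_ (h x) (count-Σ₂ {q = q} h xs) ⟩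
  Σ₂ (λ a b → χ (q a b x)) + Σ₂ (λ a b → count (q a b) xs) ≡⟨ Σ₂-+ (λ a b → χ (q a b x)) (λ a b → count (q a b) xs) ⟩
  Σ₂ (λ a b → χ (q a b x) + count (q a b) xs)              ≡⟨ Σ₂-cong (λ a b → sym (count-∷ (q a b) x xs)) ⟩
  Σ₂ (λ a b → count (q a b) (x ∷ xs))                      ∎
  where open ≡-Reasoning

-- M(n+1) as a pentagon glued to a shifted M(n)

Adjacency : Set
Adjacency = ℕ → ℕ → Bool

-- `edges` recurses through a `where`-bound helper that cannot be named here: the meta in the type
-- of `edges-go` is solved at its use below, where that helper is applied to a fresh variable.
concatMap-unique : {g : List ℕ → List (ℕ × ℕ)} → (∀ i is → g (i ∷ is) ≡ cycleEdges i ++ g is) →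
                   g [] ≡ [] → ∀ is → g is ≡ concatMap cycleEdges is
concatMap-unique g∷ g[] []       = g[]
concatMap-unique g∷ g[] (i ∷ is) = trans (g∷ i is) (cong (cycleEdges i ++_) (concatMap-unique g∷ g[] is))

mutual
  private
    edges-go : (n : ℕ) (is : List ℕ) → _ ≡ concatMap cycleEdges is
    edges-go n = concatMap-unique (λ _ _ → refl) refl

  edges≡concatMap : ∀ n → edges n ≡ concatMap cycleEdges (upTo n)
  edges≡concatMap n with upTo n
  ... | is = edges-go n is

joins : ℕ → ℕ → ℕ × ℕ → Bool
joins u v (a , b) = ((a ≡ᵇ u) ∧ (b ≡ᵇ v)) ∨ ((a ≡ᵇ v) ∧ (b ≡ᵇ u))

joins-comm : ∀ u v e → joins u v e ≡ joins v u e
joins-comm u v (a , b) = ∨-comm ((a ≡ᵇ u) ∧ (b ≡ᵇ v)) _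

cycleAdj : ℕ → Adjacency
cycleAdj i u v = any (joins u v) (cycleEdges i)

cycleAdj-comm : ∀ i u v → cycleAdj i u v ≡ cycleAdj i v u
cycleAdj-comm i u v = any-cong (joins-comm u v) (cycleEdges i)

adjℕ≡any-cycleAdj : ∀ n u v → adjℕ n u v ≡ any (λ i → cycleAdj i u v) (upTo n)
adjℕ≡any-cycleAdj n u v =
  trans (cong (any (joins u v)) (edges≡concatMap n)) (any-concatMap (joins u v) cycleEdges (upTo n))

shift₄ : ℕ × ℕ → ℕ × ℕ
shift₄ (a , b) = (4 + a , 4 + b)

cycleEdges-suc : ∀ i → cycleEdges (suc i) ≡ map shift₄ (cycleEdges i)
cycleEdges-suc i = cong pentagonFrom (*-suc 4 i)
  where
  pentagonFrom : ℕ → List (ℕ × ℕ)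
  pentagonFrom x = (x , x + 1) ∷ (x + 1 , x + 4) ∷ (x + 4 , x + 2) ∷ (x + 2 , x + 3) ∷ (x + 3 , x) ∷ []

cycleAdj-suc : ∀ i u v → cycleAdj (suc i) u v ≡ any (joins u v ∘ shift₄) (cycleEdges i)
cycleAdj-suc i u v = trans (cong (any (joins u v)) (cycleEdges-suc i)) (any-map (joins u v) shift₄ (cycleEdges i))

cycleAdj-shift : ∀ i u v → cycleAdj (suc i) (4 + u) (4 + v) ≡ cycleAdj i u v
cycleAdj-shift i u v = cycleAdj-suc i (4 + u) (4 + v)

joins-shift₄-low : ∀ u v {_ : T (u <ᵇ 4)} e → joins u v (shift₄ e) ≡ false
joins-shift₄-low 0 v (a , b) = ∧-zeroʳ _
joins-shift₄-low 1 v (a , b) = ∧-zeroʳ _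
joins-shift₄-low 2 v (a , b) = ∧-zeroʳ _
joins-shift₄-low 3 v (a , b) = ∧-zeroʳ _

cycleAdj-suc-low : ∀ i u v {_ : T (u <ᵇ 4)} → cycleAdj (suc i) u v ≡ false
cycleAdj-suc-low i u v {u<4} =
  trans (cycleAdj-suc i u v) (trans (any-cong (joins-shift₄-low u v {u<4}) (cycleEdges i)) (any-false (cycleEdges i)))

cycleAdj-zero-high : ∀ u v → cycleAdj 0 (4 + u) (4 + v) ≡ false
cycleAdj-zero-high zero    zero    = refl
cycleAdj-zero-high zero    (suc v) = refl
cycleAdj-zero-high (suc u) zero    = refl
cycleAdj-zero-high (suc u) (suc v) = refl

tailAdj : ℕ → Adjacency
tailAdj n u v = any (λ i → cycleAdj (suc i) u v) (upTo n)

adjℕ-suc-split : ∀ n u v → adjℕ (suc n) u v ≡ cycleAdj 0 u v ∨ tailAdj n u v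
adjℕ-suc-split n u v = trans (adjℕ≡any-cycleAdj (suc n) u v) (cong (cycleAdj 0 u v ∨_) tail)
  where
  tail : any (λ i → cycleAdj i u v) (applyUpTo suc n) ≡ tailAdj n u v
  tail = trans (cong (any (λ i → cycleAdj i u v)) (sym (map-applyUpTo id suc n)))
               (any-map (λ i → cycleAdj i u v) suc (upTo n))

tailAdj-shift : ∀ n u v → tailAdj n (4 + u) (4 + v) ≡ adjℕ n u v
tailAdj-shift n u v = trans (any-cong (λ i → cycleAdj-shift i u v) (upTo n)) (sym (adjℕ≡any-cycleAdj n u v))

tailAdj-lowˡ : ∀ n u v {_ : T (u <ᵇ 4)} → tailAdj n u v ≡ false
tailAdj-lowˡ n u v {u<4} = trans (any-cong (λ i → cycleAdj-suc-low i u v {u<4}) (upTo n)) (any-false (upTo n))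

tailAdj-lowʳ : ∀ n u v {_ : T (v <ᵇ 4)} → tailAdj n u v ≡ false
tailAdj-lowʳ n u v {v<4} = trans (any-cong (λ i → cycleAdj-comm (suc i) u v) (upTo n)) (tailAdj-lowˡ n v u {v<4})

attach : Adjacency → Adjacency
attach A (suc (suc (suc (suc u)))) (suc (suc (suc (suc v)))) = A u v
attach A u v = cycleAdj 0 u v

adjℕ-suc : ∀ n u v → adjℕ (suc n) u v ≡ attach (adjℕ n) u v
adjℕ-suc n u v = trans (adjℕ-suc-split n u v) (glue u v)
  where
  low : ∀ u v → tailAdj n u v ≡ false → cycleAdj 0 u v ∨ tailAdj n u v ≡ cycleAdj 0 u v
  low u v h = trans (cong (cycleAdj 0 u v ∨_) h) (∨-identityʳ _)

  glue : ∀ u v → cycleAdj 0 u v ∨ tailAdj n u v ≡ attach (adjℕ n) u v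
  glue (suc (suc (suc (suc u)))) (suc (suc (suc (suc v)))) =
    trans (cong (_∨ tailAdj n (4 + u) (4 + v)) (cycleAdj-zero-high u v)) (tailAdj-shift n u v)
  glue 0 v = low 0 v (tailAdj-lowˡ n 0 v)
  glue 1 v = low 1 v (tailAdj-lowˡ n 1 v)
  glue 2 v = low 2 v (tailAdj-lowˡ n 2 v)
  glue 3 v = low 3 v (tailAdj-lowˡ n 3 v)
  glue (suc (suc (suc (suc u)))) 0 = low (4 + u) 0 (tailAdj-lowʳ n (4 + u) 0)
  glue (suc (suc (suc (suc u)))) 1 = low (4 + u) 1 (tailAdj-lowʳ n (4 + u) 1)
  glue (suc (suc (suc (suc u)))) 2 = low (4 + u) 2 (tailAdj-lowʳ n (4 + u) 2)
  glue (suc (suc (suc (suc u)))) 3 = low (4 + u) 3 (tailAdj-lowʳ n (4 + u) 3)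

-- Almost maximal independent sets

Independent : ∀ {K} → Adjacency → Vec Bool K → Bool
Independent A S = allᶠ λ u → allᶠ λ v → not (A (toℕ u) (toℕ v) ∧ (lookup S u ∧ lookup S v))

DominatedAt : ∀ {K} → Adjacency → Vec Bool K → Fin K → Bool
DominatedAt A S v = lookup S v ∨ anyᶠ λ u → A (toℕ u) (toℕ v) ∧ lookup S u

rootDominated : ∀ {K} → Adjacency → Vec Bool (suc K) → Bool
rootDominated A S = DominatedAt A S zero

DominatingBeyondRoot : ∀ {K} → Adjacency → Vec Bool (suc K) → Bool
DominatingBeyondRoot A S = allᶠ λ v → DominatedAt A S (suc v)

AlmostMaximal : ∀ {K} → Adjacency → Vec Bool (suc K) → Bool
AlmostMaximal A S = Independent A S ∧ DominatingBeyondRoot A S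

infix 7 _⇔ᵇ_
_⇔ᵇ_ : Bool → Bool → Bool
x ⇔ᵇ y = not (x xor y)

AlmostMaximalWithRoot : ∀ {K} → Adjacency → Bool → Bool → Vec Bool (suc K) → Bool
AlmostMaximalWithRoot A x y S = (lookup S zero ⇔ᵇ x) ∧ (rootDominated A S ⇔ᵇ y) ∧ AlmostMaximal A S

module _ {A A′ : Adjacency} (A≗A′ : ∀ u v → A u v ≡ A′ u v) where

  Independent-cong : ∀ {K} (S : Vec Bool K) → Independent A S ≡ Independent A′ S
  Independent-cong S = allᶠ-cong λ u → allᶠ-cong λ v →
    cong (λ a → not (a ∧ (lookup S u ∧ lookup S v))) (A≗A′ (toℕ u) (toℕ v))

  DominatedAt-cong : ∀ {K} (S : Vec Bool K) v → DominatedAt A S v ≡ DominatedAt A′ S v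
  DominatedAt-cong S v = cong (lookup S v ∨_) (anyᶠ-cong λ u → cong (_∧ lookup S u) (A≗A′ (toℕ u) (toℕ v)))

  AlmostMaximalWithRoot-cong : ∀ {K} x y (S : Vec Bool (suc K)) →
                               AlmostMaximalWithRoot A x y S ≡ AlmostMaximalWithRoot A′ x y S
  AlmostMaximalWithRoot-cong x y S =
    cong₂ (λ d c → (lookup S zero ⇔ᵇ x) ∧ (d ⇔ᵇ y) ∧ c)
          (DominatedAt-cong S zero)
          (cong₂ _∧_ (Independent-cong S) (allᶠ-cong λ v → DominatedAt-cong S (suc v)))

isMaximalIndependent≡ : ∀ n (S : VSet n) →
  isMaximalIndependent n S ≡ AlmostMaximal (adjℕ n) S ∧ rootDominated (adjℕ n) S
isMaximalIndependent≡ n S =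
  trans (cong₂ _∧_ independent dominating)
        (by-truth-table 3 (λ i d b → i ∧ d ∧ b) (λ i d b → (i ∧ b) ∧ d)
                          (Independent A S) (rootDominated A S) (DominatingBeyondRoot A S))
  where
  A = adjℕ n

  independent : isIndependent n S ≡ Independent A S
  independent =
    trans (all-tabulate (λ u → all (λ v → not (lookup S u ∧ lookup S v ∧ adj n u v)) (allFin (V n))) id)
          (allᶠ-cong λ u → trans (all-tabulate (λ v → not (lookup S u ∧ lookup S v ∧ adj n u v)) id)
                                 (allᶠ-cong λ v → by-truth-table 3 (λ x y a → not (x ∧ y ∧ a)) (λ x y a → not (a ∧ (x ∧ y)))
                                                                   (lookup S u) (lookup S v) (A (toℕ u) (toℕ v))))

  dominating : isDominating n S ≡ allᶠ (DominatedAt A S)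
  dominating =
    trans (all-tabulate (λ v → lookup S v ∨ any (λ u → lookup S u ∧ adj n u v) (allFin (V n))) id)
          (allᶠ-cong λ v → cong (lookup S v ∨_)
            (trans (any-tabulate (λ u → lookup S u ∧ adj n u v) id)
                   (anyᶠ-cong λ u → ∧-comm (lookup S u) (A (toℕ u) (toℕ v)))))

-- Extending by the new pentagon

nand : Bool → Bool → Bool
nand x y = not (x ∧ y)

pentagonIndependent : Bool → Bool → Bool → Bool → Bool → Bool
pentagonIndependent b₀ b₁ b₂ b₃ r = nand b₀ b₁ ∧ nand b₁ r ∧ nand r b₂ ∧ nand b₂ b₃ ∧ nand b₃ b₀

pentagonDominated : Bool → Bool → Bool → Bool → Bool → Bool → Bool
pentagonDominated b₀ b₁ b₂ b₃ r d = (b₁ ∨ b₀ ∨ r) ∧ (b₂ ∨ b₃ ∨ r) ∧ (b₃ ∨ b₀ ∨ b₂) ∧ (d ∨ b₁ ∨ b₂)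

extends : Bool → Bool → Bool → Bool → Bool → Bool → Bool → Bool → Bool
extends x y b₀ b₁ b₂ b₃ r d =
  (b₀ ⇔ᵇ x) ∧ ((b₀ ∨ b₁ ∨ b₃) ⇔ᵇ y) ∧ pentagonIndependent b₀ b₁ b₂ b₃ r ∧ pentagonDominated b₀ b₁ b₂ b₃ r d

-- `unfolded` is the normal form of the left-hand side, row by row, with t, X and Y standing for the
-- parts that depend on R: the entries of rows 0–3 beyond column 4 (each `true`, as these vertices
-- have no neighbour there) and the two halves of `Independent A (r ∷ R)`.
Independent-attach : ∀ {K} A b₀ b₁ b₂ b₃ r (R : Vec Bool K) →
  Independent (attach A) (b₀ ∷ b₁ ∷ b₂ ∷ b₃ ∷ r ∷ R) ≡ pentagonIndependent b₀ b₁ b₂ b₃ r ∧ Independent A (r ∷ R)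
Independent-attach {K} A b₀ b₁ b₂ b₃ r R =
  trans (by-truth-table 8 unfolded (λ b₀ b₁ b₂ b₃ r t X Y → pentagonIndependent b₀ b₁ b₂ b₃ r ∧ (t ∧ (X ∧ Y)))
                        b₀ b₁ b₂ b₃ r (allᶠ {K} λ _ → true) _ _)
        (cong (λ t → pentagonIndependent b₀ b₁ b₂ b₃ r ∧ (t ∧ Independent A (r ∷ R))) (allᶠ-true K))
  where
  unfolded : BoolFun 8
  unfolded b₀ b₁ b₂ b₃ r t X Y =
    (nand b₀ b₁ ∧ nand b₀ b₃ ∧ t) ∧ (nand b₁ b₀ ∧ nand b₁ r ∧ t) ∧ (nand b₂ b₃ ∧ nand b₂ r ∧ t) ∧
    (nand b₃ b₀ ∧ nand b₃ b₂ ∧ t) ∧ (nand r b₁ ∧ nand r b₂ ∧ X) ∧ Y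

-- Likewise; f collects the neighbours of vertices 1–3 inside R (there are none) and Z those of r.
DominatingBeyondRoot-attach : ∀ {K} A b₀ b₁ b₂ b₃ r (R : Vec Bool K) →
  DominatingBeyondRoot (attach A) (b₀ ∷ b₁ ∷ b₂ ∷ b₃ ∷ r ∷ R) ≡
  pentagonDominated b₀ b₁ b₂ b₃ r (rootDominated A (r ∷ R)) ∧ DominatingBeyondRoot A (r ∷ R)
DominatingBeyondRoot-attach {K} A b₀ b₁ b₂ b₃ r R =
  trans (cong (λ f → unfolded b₀ b₁ b₂ b₃ r f Z (DominatingBeyondRoot A (r ∷ R))) (anyᶠ-false K))
        (by-truth-table 7 (λ b₀ b₁ b₂ b₃ r Z W → unfolded b₀ b₁ b₂ b₃ r false Z W)
                          (λ b₀ b₁ b₂ b₃ r Z W → pentagonDominated b₀ b₁ b₂ b₃ r (r ∨ Z) ∧ W)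
                          b₀ b₁ b₂ b₃ r _ _)
  where
  Z : Bool
  Z = anyᶠ λ u → A (toℕ u) 0 ∧ lookup (r ∷ R) u

  unfolded : BoolFun 8
  unfolded b₀ b₁ b₂ b₃ r f Z W =
    (b₁ ∨ b₀ ∨ r ∨ f) ∧ (b₂ ∨ b₃ ∨ r ∨ f) ∧ (b₃ ∨ b₀ ∨ b₂ ∨ f) ∧ (r ∨ b₁ ∨ b₂ ∨ Z) ∧ W

rootDominated-attach : ∀ {K} A b₀ b₁ b₂ b₃ (R : Vec Bool (suc K)) →
  rootDominated (attach A) (b₀ ∷ b₁ ∷ b₂ ∷ b₃ ∷ R) ≡ b₀ ∨ b₁ ∨ b₃
rootDominated-attach {K} A b₀ b₁ b₂ b₃ R =
  trans (cong (λ f → b₀ ∨ b₁ ∨ b₃ ∨ f) (anyᶠ-false K)) (cong (λ z → b₀ ∨ b₁ ∨ z) (∨-identityʳ b₃))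

AlmostMaximalWithRoot-attach : ∀ {K} A x y b₀ b₁ b₂ b₃ (R : Vec Bool (suc K)) →
  AlmostMaximalWithRoot (attach A) x y (b₀ ∷ b₁ ∷ b₂ ∷ b₃ ∷ R) ≡
  AlmostMaximal A R ∧ extends x y b₀ b₁ b₂ b₃ (lookup R zero) (rootDominated A R)
AlmostMaximalWithRoot-attach A x y b₀ b₁ b₂ b₃ (r ∷ R) =
  trans (cong₂ (λ d c → (b₀ ⇔ᵇ x) ∧ (d ⇔ᵇ y) ∧ c)
               (rootDominated-attach A b₀ b₁ b₂ b₃ (r ∷ R))
               (cong₂ _∧_ (Independent-attach A b₀ b₁ b₂ b₃ r R) (DominatingBeyondRoot-attach A b₀ b₁ b₂ b₃ r R)))
        (by-truth-table 6 (λ e₁ e₂ p i q d → e₁ ∧ e₂ ∧ (p ∧ i) ∧ (q ∧ d)) (λ e₁ e₂ p i q d → (i ∧ d) ∧ e₁ ∧ e₂ ∧ p ∧ q)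
                          (b₀ ⇔ᵇ x) ((b₀ ∨ b₁ ∨ b₃) ⇔ᵇ y)
                          (pentagonIndependent b₀ b₁ b₂ b₃ r) (Independent A (r ∷ R))
                          (pentagonDominated b₀ b₁ b₂ b₃ r (rootDominated A (r ∷ R))) (DominatingBeyondRoot A (r ∷ R)))

-- The transfer matrix and the recurrence

χ-split-by-root : ∀ (h : Bool → Bool → Bool) a d c →
  χ (c ∧ h a d) ≡ Σ₂ (λ x y → χ (((a ⇔ᵇ x) ∧ (d ⇔ᵇ y) ∧ c) ∧ h x y))
χ-split-by-root h true  true  c = sym (+-identityʳ _)
χ-split-by-root h true  false c = sym (+-identityʳ _)
χ-split-by-root h false true  c = sym (+-identityʳ _)
χ-split-by-root h false false c = refl

count-by-root-state : ∀ {K} A (h : Bool → Bool → Bool) (Ss : List (Vec Bool (suc K))) →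
  count (λ S → AlmostMaximal A S ∧ h (lookup S zero) (rootDominated A S)) Ss ≡
  Σ₂ (λ x y → χ (h x y) * count (AlmostMaximalWithRoot A x y) Ss)
count-by-root-state A h Ss =
  trans (count-Σ₂ {q = λ x y S → AlmostMaximalWithRoot A x y S ∧ h x y}
                  (λ S → χ-split-by-root h (lookup S zero) (rootDominated A S) (AlmostMaximal A S)) Ss)
        (Σ₂-cong λ x y → count-∧ (AlmostMaximalWithRoot A x y) (h x y) Ss)

rootCount : ℕ → ByRootState
rootCount n x y = count (AlmostMaximalWithRoot (adjℕ n) x y) (allSubsets (V n))

transfer : Bool → Bool → ByRootState
transfer x y r d = ΣBool λ b₀ → ΣBool λ b₁ → ΣBool λ b₂ → ΣBool λ b₃ → χ (extends x y b₀ b₁ b₂ b₃ r d)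

rootCount-suc : ∀ n x y → rootCount (suc n) x y ≡ Σ₂ λ r d → transfer x y r d * rootCount n r d
rootCount-suc n x y = begin
  count (AlmostMaximalWithRoot (adjℕ (suc n)) x y) (allSubsets (suc (4 * suc n)))
    ≡⟨ cong (λ K → count (AlmostMaximalWithRoot {K} (adjℕ (suc n)) x y) (allSubsets (suc K))) (*-suc 4 n) ⟩
  count (AlmostMaximalWithRoot (adjℕ (suc n)) x y) (allSubsets (4 + V n))
    ≡⟨ count-cong (AlmostMaximalWithRoot-cong (adjℕ-suc n) x y) (allSubsets (4 + V n)) ⟩
  count (AlmostMaximalWithRoot (attach A) x y) (allSubsets (4 + V n))
    ≡⟨ count-allSubsets-4+ (V n) (AlmostMaximalWithRoot (attach A) x y) ⟩
  (ΣBool λ b₀ → ΣBool λ b₁ → ΣBool λ b₂ → ΣBool λ b₃ →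
     count (λ R → AlmostMaximalWithRoot (attach A) x y (b₀ ∷ b₁ ∷ b₂ ∷ b₃ ∷ R)) (allSubsets (V n)))
    ≡⟨ (ΣBool-cong λ b₀ → ΣBool-cong λ b₁ → ΣBool-cong λ b₂ → ΣBool-cong λ b₃ →
         trans (count-cong (AlmostMaximalWithRoot-attach A x y b₀ b₁ b₂ b₃) (allSubsets (V n)))
               (count-by-root-state A (extends x y b₀ b₁ b₂ b₃) (allSubsets (V n)))) ⟩
  (ΣBool λ b₀ → ΣBool λ b₁ → ΣBool λ b₂ → ΣBool λ b₃ → Σ₂ λ r d →
     χ (extends x y b₀ b₁ b₂ b₃ r d) * rootCount n r d)
    ≡⟨ ΣBool⁴-Σ₂ (λ b₀ b₁ b₂ b₃ r d → χ (extends x y b₀ b₁ b₂ b₃ r d)) (rootCount n) ⟩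
  (Σ₂ λ r d → transfer x y r d * rootCount n r d) ∎
  where
  open ≡-Reasoning
  A = adjℕ n

rootCount-suc-FF : ∀ n → rootCount (suc n) false false ≡ 0
rootCount-suc-FF n = rootCount-suc n false false

rootCount-suc-TT : ∀ n →
  rootCount (suc n) true true ≡ rootCount n true true + rootCount n false true + rootCount n false false
rootCount-suc-TT n = trans (rootCount-suc n true true)
  (row (rootCount n true true) (rootCount n true false) (rootCount n false true) (rootCount n false false))
  where
  row : ∀ a b c d → 1 * a + (0 * b + (1 * c + 1 * d)) ≡ a + c + d
  row = solve-∀

rootCount-suc-FT : ∀ n →
  rootCount (suc n) false true ≡ rootCount n true true + 2 * (rootCount n false true + rootCount n false false)
rootCount-suc-FT n = trans (rootCount-suc n false true)
  (row (rootCount n true true) (rootCount n true false) (rootCount n false true) (rootCount n false false))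
  where
  row : ∀ a b c d → 1 * a + (0 * b + (2 * c + 2 * d)) ≡ a + 2 * (c + d)
  row = solve-∀

m≡rootCount : ∀ n → m n ≡ rootCount n true true + rootCount n false true
m≡rootCount n = begin
  m n                                ≡⟨ count-cong (isMaximalIndependent≡ n) (allSubsets (V n)) ⟩
  count (λ S → AlmostMaximal A S ∧ rootDominated A S) (allSubsets (V n))
                                     ≡⟨ count-by-root-state A (λ _ y → y) (allSubsets (V n)) ⟩
  Σ₂ (λ x y → χ y * rootCount n x y) ≡⟨ row (rootCount n true true) (rootCount n true false)
                                             (rootCount n false true) (rootCount n false false) ⟩
  rootCount n true true + rootCount n false true ∎
  where
  open ≡-Reasoning
  A = adjℕ n
  row : ∀ a b c d → 1 * a + (0 * b + (1 * c + 0 * d)) ≡ a + c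
  row = solve-∀

module _ (n : ℕ) where
  private
    p = rootCount (suc n) true true
    q = rootCount (suc n) false true

  rootCount-2+-TT : rootCount (2 + n) true true ≡ p + q
  rootCount-2+-TT =
    trans (rootCount-suc-TT (suc n)) (trans (cong (p + q +_) (rootCount-suc-FF n)) (+-identityʳ (p + q)))

  rootCount-2+-FT : rootCount (2 + n) false true ≡ p + 2 * q
  rootCount-2+-FT =
    trans (rootCount-suc-FT (suc n)) (cong (λ f → p + 2 * f) (trans (cong (q +_) (rootCount-suc-FF n)) (+-identityʳ q)))

m-recurrence : ∀ n → m (3 + n) + m (1 + n) ≡ 3 * m (2 + n)
m-recurrence n = begin
  m (3 + n) + m (1 + n)                    ≡⟨ cong₂ _+_ (m≡rootCount (3 + n)) (m≡rootCount (1 + n)) ⟩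
  rootCount (3 + n) true true + rootCount (3 + n) false true + (p + q)
                                           ≡⟨ cong (_+ (p + q)) (cong₂ _+_ (rootCount-2+-TT (1 + n)) (rootCount-2+-FT (1 + n))) ⟩
  (P + Q) + (P + 2 * Q) + (p + q)          ≡⟨ cong₂ (λ P Q → (P + Q) + (P + 2 * Q) + (p + q)) (rootCount-2+-TT n) (rootCount-2+-FT n) ⟩
  ((p + q) + (p + 2 * q)) + ((p + q) + 2 * (p + 2 * q)) + (p + q)
                                           ≡⟨ algebra p q ⟩
  3 * ((p + q) + (p + 2 * q))              ≡⟨ cong (3 *_) (sym (cong₂ _+_ (rootCount-2+-TT n) (rootCount-2+-FT n))) ⟩
  3 * (P + Q)                              ≡⟨ cong (3 *_) (sym (m≡rootCount (2 + n))) ⟩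
  3 * m (2 + n)                            ∎
  where
  open ≡-Reasoning
  p = rootCount (1 + n) true true
  q = rootCount (1 + n) false true
  P = rootCount (2 + n) true true
  Q = rootCount (2 + n) false true
  algebra : ∀ p q → ((p + q) + (p + 2 * q)) + ((p + q) + 2 * (p + 2 * q)) + (p + q) ≡ 3 * ((p + q) + (p + 2 * q))
  algebra = solve-∀

theorem2p13 : (m 1 ≡ 5) × (m 2 ≡ 13) ×
              ((n : ℕ) → m (suc (suc (suc n))) ≡ 3 * m (suc (suc n)) ∸ m (suc n))
theorem2p13 = refl , refl , λ n →
  sym (trans (cong (_∸ m (1 + n)) (sym (m-recurrence n))) (m+n∸n≡m (m (3 + n)) (m (1 + n))))
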